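{- Let $V$ be a finite set of cardinality $v$ and let $D_1,D_2$ be block designs built on $V$ with parameters $(v,b_i,r_i,k_i,\lambda_i)$, $i=1,2$, with blocks listed as $B_1^1,\dots,B_1^{b_1}$ and $B_2^1,\dots,B_2^{b_2}$. Let $M$ be the $b_1\times b_2$ matrix with entries $M_{ij}=|B_1^i\cap B_2^j|$. Then $(r_1-\lambda_1)(r_2-\lambda_2)$ is an eigenvalue of $MM^T$, and its eigenspace contains the space $V_{D_1}$.
   Context: A (balanced incomplete) block design with parameters $(v,b,r,k,\lambda)$ built on a finite set $V$ with $|V|=v$ is a list (repetitions allowed) of $b$ blocks, each a $k$-element subset of $V$ with $k<v$, such that every element of $V$ lies in exactly $r$ blocks and every pair of distinct elements of $V$ lies in exactly $\lambda$ blocks; here $b,r,k,\lambda$ are positive integers, except that the paper also regards the design whose blocks are the $v$ one-element subsets of $V$ (parameters $b=v$, $r=k=1$, $\lambda=0$) as a block design. For a block design $D_i$ on $V$ with blocks $B_i^1,\dots,B_i^{b_i}$ and for $x,y\in V$, define $\mathcal Z_{D_i}(x,y)\in\mathbb R^{b_i}$ by its $j$-th component: $0$ if both $x,y\in B_i^j$ or both $x,y\notin B_i^j$; $1$ if $x\in B_i^j$ and $y\notin B_i^j$; $-1$ if $x\notin B_i^j$ and $y\in B_i^j$. Let $V_{D_i}=\mathrm{Span}\{\mathcal Z_{D_i}(x,y): x,y\in V\}\subseteq\mathbb R^{b_i}$.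
   Formalization: The space $V_{D_1}$ and the eigenvectors of $MM^T$ are taken over ℚ, with rational coefficients, rather than over ℝ. -}

module Defs where

open import Data.Nat as ℕ using (ℕ; zero; suc; _<_)
open import Data.Fin using (Fin; zero; suc)
open import Data.Fin.Subset using (Subset; _∈_; ∣_∣; _∩_)
open import Data.Fin.Subset.Properties using (_∈?_)
open import Data.Integer as ℤ using (ℤ; +_)
open import Data.Rational using (ℚ; 0ℚ; 1ℚ; -_; _+_; _*_; _/_)
open import Data.Product using (Σ; ∃; _×_)
open import Data.Sum using (_⊎_)
open import Relation.Nullary using (¬_; yes; no; Dec)
open import Relation.Nullary.Decidable using (_×-dec_)
open import Relation.Binary.PropositionalEquality using (_≡_; _≢_)

count : ∀ {n} {P : Fin n → Set} → ((j : Fin n) → Dec (P j)) → ℕ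
count {zero} P? = 0
count {suc n} P? with P? zero
... | yes _ = suc (count (λ j → P? (suc j)))
... | no  _ = count (λ j → P? (suc j))

∑ : ∀ {n} → (Fin n → ℚ) → ℚ
∑ {zero} f = 0ℚ
∑ {suc n} f = f zero + ∑ (λ j → f (suc j))

ℕ→ℚ : ℕ → ℚ
ℕ→ℚ n = + n / 1

ℤ→ℚ : ℤ → ℚ
ℤ→ℚ z = z / 1

-- Positivity of b,r,k,λ, except for the special design
-- of the v singletons (b = v, r = k = 1, λ = 0).
record IsBlockDesign (v b r k lam : ℕ) (B : Fin b → Subset v) : Set where
  field
    blockSize   : ∀ j → ∣ B j ∣ ≡ k
    k<v         : k < v
    replication : ∀ (x : Fin v) → count (λ j → x ∈? B j) ≡ r
    balance     : ∀ (x y : Fin v) → x ≢ y →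
                  count (λ j → (x ∈? B j) ×-dec (y ∈? B j)) ≡ lam
    positivity  : (0 < b × 0 < r × 0 < k × 0 < lam)
                ⊎ (b ≡ v × r ≡ 1 × k ≡ 1 × lam ≡ 0)

interMat : ∀ {v b1 b2} → (Fin b1 → Subset v) → (Fin b2 → Subset v) → Fin b1 → Fin b2 → ℚ
interMat B1 B2 i j = ℕ→ℚ ∣ B1 i ∩ B2 j ∣

transpose : ∀ {m n} → (Fin m → Fin n → ℚ) → Fin n → Fin m → ℚ
transpose A j i = A i j

matMul : ∀ {m n p} → (Fin m → Fin n → ℚ) → (Fin n → Fin p → ℚ) → Fin m → Fin p → ℚ
matMul A C i l = ∑ (λ j → A i j * C j l)

matVec : ∀ {m n} → (Fin m → Fin n → ℚ) → (Fin n → ℚ) → Fin m → ℚ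
matVec A u i = ∑ (λ j → A i j * u j)

Zvec : ∀ {v b} → (Fin b → Subset v) → Fin v → Fin v → Fin b → ℚ
Zvec B x y j with x ∈? B j | y ∈? B j
... | yes _ | yes _ = 0ℚ
... | no  _ | no  _ = 0ℚ
... | yes _ | no  _ = 1ℚ
... | no  _ | yes _ = - 1ℚ

-- u ∈ V_D = Span { Z_D(x,y) : x, y ∈ V }  (linear combinations with rational coefficients)
InSpanZ : ∀ {v b} → (Fin b → Subset v) → (Fin b → ℚ) → Set
InSpanZ {v} B u = Σ (Fin v → Fin v → ℚ) λ c →
  ∀ j → u j ≡ ∑ (λ x → ∑ (λ y → c x y * Zvec B x y j))

IsEigenvalue : ∀ {n} → (Fin n → Fin n → ℚ) → ℚ → Set
IsEigenvalue {n} A μ = Σ (Fin n → ℚ) λ u → (∃ λ j → u j ≢ 0ℚ) × (∀ i → matVec A u i ≡ μ * u i)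

EigenspaceContains : ∀ {n} → (Fin n → Fin n → ℚ) → ℚ → ((Fin n → ℚ) → Set) → Set
EigenspaceContains {n} A μ Q = ∀ (u : Fin n → ℚ) → Q u → ∀ i → matVec A u i ≡ μ * u i

-- Let N be the v × b incidence matrix of a design. Replication and balance say
-- N Nᵀ = λ J + (r − λ) I, so N Nᵀ d = (r − λ) d whenever the entries of d sum to 0.
-- The intersection matrix is M = N₁ᵀ N₂, hence for such d
--   M Mᵀ (N₁ᵀ d) = N₁ᵀ (N₂ N₂ᵀ) (N₁ N₁ᵀ) d = (r₁ − λ₁)(r₂ − λ₂) N₁ᵀ d.
-- Every Z_{D₁}(x,y) is N₁ᵀ (eₓ − e_y), and a block containing x but not y makes it nonzero.
module Submission where

open import Defs
open import Algebra.Bundles using (CommutativeMonoid; CommutativeRing)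
open import Data.Bool using (Bool; true; false; _∧_)
open import Data.Vec using ([]; _∷_)
open import Data.Fin as Fin using (Fin; zero; suc)
open import Data.Fin.Subset using (Subset; inside; outside; _∩_; ∣_∣; ∁; _∈_; _∉_; Nonempty)
open import Data.Fin.Subset.Properties
  using (_∈?_; nonempty?; Empty-unique; ∣⊥∣≡0; ∣∁p∣≡n∸∣p∣; x∈∁p⇒x∉p; ∩-comm)
open import Data.Integer as ℤ using (+_; _⊖_)
import Data.Integer.Properties as ℤ
open import Data.Integer.Solver using () renaming (module +-*-Solver to ℤ-Solver)
open import Data.Nat using (ℕ; zero; suc; _<_; s≤s; z≤n)
import Data.Nat.Properties as ℕ
open import Data.Product using (∃; ∃₂; _×_; _,_)
open import Data.Rational using (ℚ; 0ℚ; 1ℚ; _+_; _*_; -_; _-_; toℚᵘ)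
import Data.Rational.Properties as ℚ
open import Data.Rational.Solver using () renaming (module +-*-Solver to ℚ-Solver)
import Data.Rational.Unnormalised as ℚᵘ
import Data.Rational.Unnormalised.Properties as ℚᵘ
open import Data.Sum using (inj₁; inj₂)
open import Function using (_∘_)
open import Relation.Binary.PropositionalEquality
open import Relation.Nullary using (Dec; yes; no; does; contradiction)
open import Relation.Nullary.Decidable using (_×-dec_)

open import Algebra.Properties.Semiring.Sum (CommutativeRing.semiring ℚ.+-*-commutativeRing)
  using (sum; sum-cong-≗; sum-replicate-zero; ∑-distrib-+; ∑-comm; *-distribˡ-sum; *-distribʳ-sum)
open import Algebra.Properties.Ring (CommutativeRing.ring ℚ.+-*-commutativeRing)
  using (-1*x≈-x)
open import Algebra.Properties.CommutativeSemigroup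
  (CommutativeMonoid.commutativeSemigroup ℚ.*-1-commutativeMonoid)
  using (x∙yz≈y∙xz)

open ≡-Reasoning

ℤ→ℚ-homo-+ : ∀ a b → ℤ→ℚ (a ℤ.+ b) ≡ ℤ→ℚ a + ℤ→ℚ b
ℤ→ℚ-homo-+ a b = ℚ.toℚᵘ-injective (ℚᵘ.≃-trans (toℚᵘ-ℤ→ℚ (a ℤ.+ b)) (ℚᵘ.≃-trans mkℚᵘ-homo-+
  (ℚᵘ.≃-sym (ℚᵘ.≃-trans (ℚ.toℚᵘ-homo-+ (ℤ→ℚ a) (ℤ→ℚ b)) (ℚᵘ.+-cong (toℚᵘ-ℤ→ℚ a) (toℚᵘ-ℤ→ℚ b))))))
  where
  toℚᵘ-ℤ→ℚ : ∀ z → toℚᵘ (ℤ→ℚ z) ℚᵘ.≃ ℚᵘ.mkℚᵘ z 0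
  toℚᵘ-ℤ→ℚ z = ℚ.toℚᵘ-fromℚᵘ (ℚᵘ.mkℚᵘ z 0)
  mkℚᵘ-homo-+ : ℚᵘ.mkℚᵘ (a ℤ.+ b) 0 ℚᵘ.≃ ℚᵘ.mkℚᵘ a 0 ℚᵘ.+ ℚᵘ.mkℚᵘ b 0
  mkℚᵘ-homo-+ = ℚᵘ.*≡* (cong (ℤ._* + 1) (sym (cong₂ ℤ._+_ (ℤ.*-identityʳ a) (ℤ.*-identityʳ b))))

ℕ→ℚ-suc : ∀ n → ℕ→ℚ (suc n) ≡ 1ℚ + ℕ→ℚ n
ℕ→ℚ-suc n = ℤ→ℚ-homo-+ (+ 1) (+ n)

ℕ→ℚ-⊖ : ∀ m n → ℕ→ℚ m ≡ ℕ→ℚ n + ℤ→ℚ (m ⊖ n)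
ℕ→ℚ-⊖ m n = trans (cong ℤ→ℚ +m≡+n+[m⊖n]) (ℤ→ℚ-homo-+ (+ n) (m ⊖ n))
  where
  open ℤ-Solver
  +m≡+n+[m⊖n] : + m ≡ + n ℤ.+ (m ⊖ n)
  +m≡+n+[m⊖n] = begin
    + m                  ≡⟨ solve 2 (λ m n → m := n :+ (m :- n)) refl (+ m) (+ n) ⟩
    + n ℤ.+ (+ m ℤ.- + n) ≡⟨ cong (ℤ._+_ (+ n)) (ℤ.[+m]-[+n]≡m⊖n m n) ⟩
    + n ℤ.+ (m ⊖ n)      ∎

∑≡sum : ∀ {n} (f : Fin n → ℚ) → ∑ f ≡ sum f
∑≡sum {zero}  f = refl
∑≡sum {suc n} f = cong (_+_ (f zero)) (∑≡sum (f ∘ suc))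

∑-cong : ∀ {n} {f g : Fin n → ℚ} → (∀ j → f j ≡ g j) → ∑ f ≡ ∑ g
∑-cong {f = f} {g} f≗g = trans (∑≡sum f) (trans (sum-cong-≗ f≗g) (sym (∑≡sum g)))

∑-zero : ∀ n → ∑ {n} (λ _ → 0ℚ) ≡ 0ℚ
∑-zero n = trans (∑≡sum {n} (λ _ → 0ℚ)) (sum-replicate-zero n)

∑-+ : ∀ {n} (f g : Fin n → ℚ) → ∑ (λ j → f j + g j) ≡ ∑ f + ∑ g
∑-+ f g = begin
  ∑ (λ j → f j + g j)     ≡⟨ ∑≡sum (λ j → f j + g j) ⟩
  sum (λ j → f j + g j)   ≡⟨ ∑-distrib-+ f g ⟩
  sum f + sum g           ≡⟨ cong₂ _+_ (∑≡sum f) (∑≡sum g) ⟨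
  ∑ f + ∑ g               ∎

*-distribˡ-∑ : ∀ {n} c (f : Fin n → ℚ) → c * ∑ f ≡ ∑ (λ j → c * f j)
*-distribˡ-∑ c f = begin
  c * ∑ f                 ≡⟨ cong (c *_) (∑≡sum f) ⟩
  c * sum f               ≡⟨ *-distribˡ-sum c f ⟩
  sum (λ j → c * f j)     ≡⟨ ∑≡sum (λ j → c * f j) ⟨
  ∑ (λ j → c * f j)       ∎

*-distribʳ-∑ : ∀ {n} c (f : Fin n → ℚ) → ∑ f * c ≡ ∑ (λ j → f j * c)
*-distribʳ-∑ c f = begin
  ∑ f * c                 ≡⟨ cong (_* c) (∑≡sum f) ⟩
  sum f * c               ≡⟨ *-distribʳ-sum c f ⟩
  sum (λ j → f j * c)     ≡⟨ ∑≡sum (λ j → f j * c) ⟨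
  ∑ (λ j → f j * c)       ∎

neg-distrib-∑ : ∀ {n} (f : Fin n → ℚ) → - ∑ f ≡ ∑ (λ j → - f j)
neg-distrib-∑ f = begin
  - ∑ f                   ≡⟨ -1*x≈-x (∑ f) ⟨
  - 1ℚ * ∑ f              ≡⟨ *-distribˡ-∑ (- 1ℚ) f ⟩
  ∑ (λ j → - 1ℚ * f j)    ≡⟨ ∑-cong (λ j → -1*x≈-x (f j)) ⟩
  ∑ (λ j → - f j)         ∎

∑∑-comm : ∀ {m n} (f : Fin m → Fin n → ℚ) →
          ∑ (λ i → ∑ (λ j → f i j)) ≡ ∑ (λ j → ∑ (λ i → f i j))
∑∑-comm f = begin
  ∑ (λ i → ∑ (f i))                  ≡⟨ ∑∑≡sumsum f ⟩
  sum (λ i → sum (f i))              ≡⟨ ∑-comm f ⟩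
  sum (λ j → sum (λ i → f i j))      ≡⟨ ∑∑≡sumsum (λ i j → f j i) ⟨
  ∑ (λ j → ∑ (λ i → f i j))          ∎
  where
  ∑∑≡sumsum : ∀ {m n} (g : Fin m → Fin n → ℚ) → ∑ (λ i → ∑ (g i)) ≡ sum (λ i → sum (g i))
  ∑∑≡sumsum g = trans (∑-cong (λ i → ∑≡sum (g i))) (∑≡sum (λ i → sum (g i)))

δ : ∀ {n} → Fin n → Fin n → ℚ
δ zero    zero    = 1ℚ
δ zero    (suc _) = 0ℚ
δ (suc _) zero    = 0ℚ
δ (suc i) (suc j) = δ i j

δ-refl : ∀ {n} (i : Fin n) → δ i i ≡ 1ℚ
δ-refl zero    = refl
δ-refl (suc i) = δ-refl i

δ-≢ : ∀ {n} {i j : Fin n} → i ≢ j → δ i j ≡ 0ℚ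
δ-≢ {i = zero}  {zero}  i≢j = contradiction refl i≢j
δ-≢ {i = zero}  {suc j} i≢j = refl
δ-≢ {i = suc i} {zero}  i≢j = refl
δ-≢ {i = suc i} {suc j} i≢j = δ-≢ (i≢j ∘ cong suc)

∑-δ : ∀ {n} (f : Fin n → ℚ) (i : Fin n) → ∑ (λ j → f j * δ i j) ≡ f i
∑-δ {suc n} f zero = begin
  f zero * 1ℚ + ∑ (λ j → f (suc j) * 0ℚ)  ≡⟨ cong₂ _+_ (ℚ.*-identityʳ (f zero))
                                                (trans (∑-cong (ℚ.*-zeroʳ ∘ f ∘ suc)) (∑-zero n)) ⟩
  f zero + 0ℚ                             ≡⟨ ℚ.+-identityʳ (f zero) ⟩
  f zero                                  ∎
∑-δ {suc n} f (suc i) = begin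
  f zero * 0ℚ + ∑ (λ j → f (suc j) * δ i j)  ≡⟨ cong₂ _+_ (ℚ.*-zeroʳ (f zero)) (∑-δ (f ∘ suc) i) ⟩
  0ℚ + f (suc i)                             ≡⟨ ℚ.+-identityˡ (f (suc i)) ⟩
  f (suc i)                                  ∎

∑-δ-δ : ∀ {n} (i j : Fin n) → ∑ (λ q → δ i q - δ j q) ≡ 0ℚ
∑-δ-δ i j = begin
  ∑ (λ q → δ i q - δ j q)          ≡⟨ ∑-+ (δ i) (λ q → - δ j q) ⟩
  ∑ (δ i) + ∑ (λ q → - δ j q)      ≡⟨ cong (_+_ (∑ (δ i))) (neg-distrib-∑ (δ j)) ⟨
  ∑ (δ i) - ∑ (δ j)                ≡⟨ cong₂ _-_ (∑δ≡1 i) (∑δ≡1 j) ⟩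
  1ℚ - 1ℚ                          ≡⟨⟩
  0ℚ                               ∎
  where
  ∑δ≡1 : ∀ i → ∑ (δ i) ≡ 1ℚ
  ∑δ≡1 i = trans (∑-cong (λ q → sym (ℚ.*-identityˡ (δ i q)))) (∑-δ (λ _ → 1ℚ) i)

𝟙 : Bool → ℚ
𝟙 true  = 1ℚ
𝟙 false = 0ℚ

𝟙-∧ : ∀ a b → 𝟙 (a ∧ b) ≡ 𝟙 a * 𝟙 b
𝟙-∧ true  b = sym (ℚ.*-identityˡ (𝟙 b))
𝟙-∧ false b = sym (ℚ.*-zeroˡ (𝟙 b))

𝟙-idem : ∀ a → 𝟙 a * 𝟙 a ≡ 𝟙 a
𝟙-idem true  = refl
𝟙-idem false = refl

count≡∑𝟙 : ∀ {n} {P : Fin n → Set} (P? : ∀ j → Dec (P j)) →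
           ℕ→ℚ (count P?) ≡ ∑ (λ j → 𝟙 (does (P? j)))
count≡∑𝟙 {zero}  P? = refl
count≡∑𝟙 {suc n} P? with P? zero
... | yes _ = trans (ℕ→ℚ-suc (count (P? ∘ suc))) (cong (_+_ 1ℚ) (count≡∑𝟙 (P? ∘ suc)))
... | no  _ = trans (count≡∑𝟙 (P? ∘ suc)) (sym (ℚ.+-identityˡ _))

incidence : ∀ {v b} → (Fin b → Subset v) → Fin v → Fin b → ℚ
incidence B p j = 𝟙 (does (p ∈? B j))

∣∩∣≡∑𝟙 : ∀ {n} (S T : Subset n) →
         ℕ→ℚ ∣ S ∩ T ∣ ≡ ∑ (λ p → 𝟙 (does (p ∈? S)) * 𝟙 (does (p ∈? T)))
∣∩∣≡∑𝟙 []            []            = refl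
∣∩∣≡∑𝟙 (inside  ∷ S) (inside  ∷ T) = trans (ℕ→ℚ-suc ∣ S ∩ T ∣) (cong (_+_ 1ℚ) (∣∩∣≡∑𝟙 S T))
∣∩∣≡∑𝟙 (inside  ∷ S) (outside ∷ T) = trans (∣∩∣≡∑𝟙 S T) (sym (ℚ.+-identityˡ _))
∣∩∣≡∑𝟙 (outside ∷ S) (inside  ∷ T) = trans (∣∩∣≡∑𝟙 S T) (sym (ℚ.+-identityˡ _))
∣∩∣≡∑𝟙 (outside ∷ S) (outside ∷ T) = trans (∣∩∣≡∑𝟙 S T) (sym (ℚ.+-identityˡ _))

0<∣p∣⇒Nonempty : ∀ {n} (p : Subset n) → 0 < ∣ p ∣ → Nonempty p
0<∣p∣⇒Nonempty {n} p 0<∣p∣ with nonempty? p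
... | yes p≢∅ = p≢∅
... | no  p≡∅ = contradiction (trans (cong ∣_∣ (Empty-unique p≡∅)) (∣⊥∣≡0 n)) (ℕ.>⇒≢ 0<∣p∣)

∣p∣<n⇒Nonfull : ∀ {n} (p : Subset n) → ∣ p ∣ < n → ∃ λ y → y ∉ p
∣p∣<n⇒Nonfull p ∣p∣<n
  with 0<∣p∣⇒Nonempty (∁ p) (subst (0 <_) (sym (∣∁p∣≡n∸∣p∣ p)) (ℕ.m<n⇒0<n∸m ∣p∣<n))
... | y , y∈∁p = y , x∈∁p⇒x∉p y∈∁p

interMat≡Nᵀ*N : ∀ {v b₁ b₂} (B₁ : Fin b₁ → Subset v) (B₂ : Fin b₂ → Subset v) i j →
                interMat B₁ B₂ i j ≡ matMul (transpose (incidence B₁)) (incidence B₂) i j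
interMat≡Nᵀ*N B₁ B₂ i j = ∣∩∣≡∑𝟙 (B₁ i) (B₂ j)

transpose-interMat : ∀ {v b₁ b₂} (B₁ : Fin b₁ → Subset v) (B₂ : Fin b₂ → Subset v) j i →
                     transpose (interMat B₁ B₂) j i ≡ interMat B₂ B₁ j i
transpose-interMat B₁ B₂ j i = cong (ℕ→ℚ ∘ ∣_∣) (∩-comm (B₁ i) (B₂ j))

module _ {m n : ℕ} where

  matVec-congˡ : ∀ {A A′ : Fin m → Fin n → ℚ} → (∀ i j → A i j ≡ A′ i j) →
                 ∀ u i → matVec A u i ≡ matVec A′ u i
  matVec-congˡ A≗A′ u i = ∑-cong (λ j → cong (_* u j) (A≗A′ i j))

  matVec-congʳ : ∀ (A : Fin m → Fin n → ℚ) {u u′} → (∀ j → u j ≡ u′ j) →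
                 ∀ i → matVec A u i ≡ matVec A u′ i
  matVec-congʳ A u≗u′ i = ∑-cong (λ j → cong (A i j *_) (u≗u′ j))

  matVec-+ : ∀ (A : Fin m → Fin n → ℚ) u w i →
             matVec A (λ j → u j + w j) i ≡ matVec A u i + matVec A w i
  matVec-+ A u w i = trans (∑-cong (λ j → ℚ.*-distribˡ-+ (A i j) (u j) (w j)))
                           (∑-+ (λ j → A i j * u j) (λ j → A i j * w j))

  matVec-* : ∀ (A : Fin m → Fin n → ℚ) c u i →
             matVec A (λ j → c * u j) i ≡ c * matVec A u i
  matVec-* A c u i = trans (∑-cong (λ j → x∙yz≈y∙xz (A i j) c (u j)))
                           (sym (*-distribˡ-∑ c (λ j → A i j * u j)))

  matVec-neg : ∀ (A : Fin m → Fin n → ℚ) u i → matVec A (λ j → - u j) i ≡ - matVec A u i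
  matVec-neg A u i = begin
    matVec A (λ j → - u j) i       ≡⟨ matVec-congʳ A (λ j → -1*x≈-x (u j)) i ⟨
    matVec A (λ j → - 1ℚ * u j) i  ≡⟨ matVec-* A (- 1ℚ) u i ⟩
    - 1ℚ * matVec A u i            ≡⟨ -1*x≈-x (matVec A u i) ⟩
    - matVec A u i                 ∎

  matVec-δ : ∀ (A : Fin m → Fin n → ℚ) i j → matVec A (δ j) i ≡ A i j
  matVec-δ A i j = ∑-δ (A i) j

matVec-matMul : ∀ {m n p} (A : Fin m → Fin n → ℚ) (C : Fin n → Fin p → ℚ) u i →
                matVec (matMul A C) u i ≡ matVec A (matVec C u) i
matVec-matMul A C u i = begin
  ∑ (λ l → ∑ (λ j → A i j * C j l) * u l)    ≡⟨ ∑-cong (λ l → *-distribʳ-∑ (u l) (λ j → A i j * C j l)) ⟩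
  ∑ (λ l → ∑ (λ j → A i j * C j l * u l))    ≡⟨ ∑∑-comm (λ l j → A i j * C j l * u l) ⟩
  ∑ (λ j → ∑ (λ l → A i j * C j l * u l))    ≡⟨ ∑-cong (λ j → ∑-cong (λ l → ℚ.*-assoc (A i j) (C j l) (u l))) ⟩
  ∑ (λ j → ∑ (λ l → A i j * (C j l * u l)))  ≡⟨ ∑-cong (λ j → *-distribˡ-∑ (A i j) (λ l → C j l * u l)) ⟨
  ∑ (λ j → A i j * ∑ (λ l → C j l * u l))    ∎

InEigenspace : ∀ {n} → (Fin n → Fin n → ℚ) → ℚ → (Fin n → ℚ) → Set
InEigenspace A μ u = ∀ i → matVec A u i ≡ μ * u i

module _ {n : ℕ} (A : Fin n → Fin n → ℚ) (μ : ℚ) where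

  InEigenspace-resp : ∀ {u w} → (∀ j → u j ≡ w j) → InEigenspace A μ u → InEigenspace A μ w
  InEigenspace-resp u≗w Au≡μu i =
    trans (matVec-congʳ A (sym ∘ u≗w) i) (trans (Au≡μu i) (cong (μ *_) (u≗w i)))

  InEigenspace-* : ∀ c {u} → InEigenspace A μ u → InEigenspace A μ (λ j → c * u j)
  InEigenspace-* c {u} Au≡μu i = begin
    matVec A (λ j → c * u j) i  ≡⟨ matVec-* A c u i ⟩
    c * matVec A u i            ≡⟨ cong (c *_) (Au≡μu i) ⟩
    c * (μ * u i)               ≡⟨ x∙yz≈y∙xz c μ (u i) ⟩
    μ * (c * u i)               ∎

  InEigenspace-∑ : ∀ {m} (F : Fin m → Fin n → ℚ) → (∀ x → InEigenspace A μ (F x)) →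
                   InEigenspace A μ (λ j → ∑ (λ x → F x j))
  InEigenspace-∑ F AF≡μF i = begin
    ∑ (λ j → A i j * ∑ (λ x → F x j))   ≡⟨ ∑-cong (λ j → *-distribˡ-∑ (A i j) (λ x → F x j)) ⟩
    ∑ (λ j → ∑ (λ x → A i j * F x j))   ≡⟨ ∑∑-comm (λ j x → A i j * F x j) ⟩
    ∑ (λ x → matVec A (F x) i)          ≡⟨ ∑-cong (λ x → AF≡μF x i) ⟩
    ∑ (λ x → μ * F x i)                 ≡⟨ *-distribˡ-∑ μ (λ x → F x i) ⟨
    μ * ∑ (λ x → F x i)                 ∎

  span-Zvec⊆eigenspace : ∀ {v} (B : Fin n → Subset v) →
                         (∀ x y → InEigenspace A μ (Zvec B x y)) →
                         EigenspaceContains A μ (InSpanZ B)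
  span-Zvec⊆eigenspace B AZ≡μZ u (c , u≡∑cZ) =
    InEigenspace-resp (sym ∘ u≡∑cZ)
      (InEigenspace-∑ _ (λ x → InEigenspace-∑ _ (λ y → InEigenspace-* (c x y) (AZ≡μZ x y))))

Zvec≡incidence-incidence : ∀ {v b} (B : Fin b → Subset v) x y j →
                           Zvec B x y j ≡ incidence B x j - incidence B y j
Zvec≡incidence-incidence B x y j with x ∈? B j | y ∈? B j
... | yes _ | yes _ = refl
... | yes _ | no  _ = refl
... | no  _ | yes _ = refl
... | no  _ | no  _ = refl

Zvec-∈-∉ : ∀ {v b} (B : Fin b → Subset v) {x y j} → x ∈ B j → y ∉ B j → Zvec B x y j ≡ 1ℚ
Zvec-∈-∉ B {x} {y} {j} x∈ y∉ with x ∈? B j | y ∈? B j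
... | yes _   | no  _   = refl
... | yes _   | yes y∈′ = contradiction y∈′ y∉
... | no  x∉′ | _       = contradiction x∈ x∉′

Zvec≡Nᵀ[δ-δ] : ∀ {v b} (B : Fin b → Subset v) x y j →
               Zvec B x y j ≡ matVec (transpose (incidence B)) (λ q → δ x q - δ y q) j
Zvec≡Nᵀ[δ-δ] {v} {b} B x y j = begin
  Zvec B x y j                                     ≡⟨ Zvec≡incidence-incidence B x y j ⟩
  N x j - N y j                                    ≡⟨ cong₂ _-_ (matVec-δ Nᵀ j x) (matVec-δ Nᵀ j y) ⟨
  matVec Nᵀ (δ x) j - matVec Nᵀ (δ y) j            ≡⟨ cong (_+_ (matVec Nᵀ (δ x) j)) (matVec-neg Nᵀ (δ y) j) ⟨
  matVec Nᵀ (δ x) j + matVec Nᵀ (λ q → - δ y q) j  ≡⟨ matVec-+ Nᵀ (δ x) (λ q → - δ y q) j ⟨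
  matVec Nᵀ (λ q → δ x q - δ y q) j                ∎
  where
  N : Fin v → Fin b → ℚ
  N = incidence B
  Nᵀ : Fin b → Fin v → ℚ
  Nᵀ = transpose N

module BlockDesign {v b r k l : ℕ} {B : Fin b → Subset v} (D : IsBlockDesign v b r k l B) where

  open IsBlockDesign D

  N : Fin v → Fin b → ℚ
  N = incidence B

  order : ℚ
  order = ℤ→ℚ (r ⊖ l)

  N*Nᵀ≡λJ+order*I : ∀ p q → matMul N (transpose N) p q ≡ ℕ→ℚ l + order * δ p q
  N*Nᵀ≡λJ+order*I p q with p Fin.≟ q
  ... | yes refl = begin
    ∑ (λ j → N p j * N p j)                   ≡⟨ ∑-cong (λ j → 𝟙-idem (does (p ∈? B j))) ⟩
    ∑ (λ j → N p j)                           ≡⟨ count≡∑𝟙 (λ j → p ∈? B j) ⟨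
    ℕ→ℚ (count (λ j → p ∈? B j))              ≡⟨ cong ℕ→ℚ (replication p) ⟩
    ℕ→ℚ r                                     ≡⟨ ℕ→ℚ-⊖ r l ⟩
    ℕ→ℚ l + order                             ≡⟨ cong (_+_ (ℕ→ℚ l)) (ℚ.*-identityʳ order) ⟨
    ℕ→ℚ l + order * 1ℚ                        ≡⟨ cong (λ δpp → ℕ→ℚ l + order * δpp) (δ-refl p) ⟨
    ℕ→ℚ l + order * δ p p                     ∎
  ... | no p≢q = begin
    ∑ (λ j → N p j * N q j)                   ≡⟨ ∑-cong (λ j → 𝟙-∧ (does (p ∈? B j)) (does (q ∈? B j))) ⟨
    ∑ (λ j → 𝟙 (does (p ∈? B j) ∧ does (q ∈? B j)))
                                              ≡⟨ count≡∑𝟙 (λ j → (p ∈? B j) ×-dec (q ∈? B j)) ⟨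
    ℕ→ℚ (count (λ j → (p ∈? B j) ×-dec (q ∈? B j)))
                                              ≡⟨ cong ℕ→ℚ (balance p q p≢q) ⟩
    ℕ→ℚ l                                     ≡⟨ ℚ.+-identityʳ (ℕ→ℚ l) ⟨
    ℕ→ℚ l + 0ℚ                                ≡⟨ cong (_+_ (ℕ→ℚ l)) (ℚ.*-zeroʳ order) ⟨
    ℕ→ℚ l + order * 0ℚ                        ≡⟨ cong (λ δpq → ℕ→ℚ l + order * δpq) (δ-≢ p≢q) ⟨
    ℕ→ℚ l + order * δ p q                     ∎

  N*Nᵀ-eigen : ∀ {d : Fin v → ℚ} → ∑ d ≡ 0ℚ → ∀ p → matVec N (matVec (transpose N) d) p ≡ order * d p
  N*Nᵀ-eigen {d} ∑d≡0 p = begin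
    matVec N (matVec (transpose N) d) p                 ≡⟨ matVec-matMul N (transpose N) d p ⟨
    matVec (matMul N (transpose N)) d p                 ≡⟨ matVec-congˡ N*Nᵀ≡λJ+order*I d p ⟩
    ∑ (λ q → (ℕ→ℚ l + order * δ p q) * d q)             ≡⟨ ∑-cong (λ q → expand (ℕ→ℚ l) order (δ p q) (d q)) ⟩
    ∑ (λ q → ℕ→ℚ l * d q + order * (d q * δ p q))       ≡⟨ ∑-+ (λ q → ℕ→ℚ l * d q) (λ q → order * (d q * δ p q)) ⟩
    ∑ (λ q → ℕ→ℚ l * d q) + ∑ (λ q → order * (d q * δ p q))
                                                        ≡⟨ cong₂ _+_ (*-distribˡ-∑ (ℕ→ℚ l) d)
                                                                     (*-distribˡ-∑ order (λ q → d q * δ p q)) ⟨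
    ℕ→ℚ l * ∑ d + order * ∑ (λ q → d q * δ p q)         ≡⟨ cong₂ (λ s t → ℕ→ℚ l * s + order * t) ∑d≡0 (∑-δ d p) ⟩
    ℕ→ℚ l * 0ℚ + order * d p                            ≡⟨ cong (_+ order * d p) (ℚ.*-zeroʳ (ℕ→ℚ l)) ⟩
    0ℚ + order * d p                                    ≡⟨ ℚ.+-identityˡ (order * d p) ⟩
    order * d p                                         ∎
    where
    open ℚ-Solver
    expand : ∀ a c e x → (a + c * e) * x ≡ a * x + c * (x * e)
    expand = solve 4 (λ a c e x → (a :+ c :* e) :* x := a :* x :+ c :* (x :* e)) refl

  interMat-eigen : ∀ {b′} (B′ : Fin b′ → Subset v) {d : Fin v → ℚ} → ∑ d ≡ 0ℚ → ∀ i →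
                   matVec (interMat B′ B) (matVec (transpose N) d) i
                     ≡ order * matVec (transpose (incidence B′)) d i
  interMat-eigen {b′} B′ {d} ∑d≡0 i = begin
    matVec (interMat B′ B) (matVec (transpose N) d) i  ≡⟨ matVec-congˡ (interMat≡Nᵀ*N B′ B) _ i ⟩
    matVec (matMul N′ᵀ N) (matVec (transpose N) d) i   ≡⟨ matVec-matMul N′ᵀ N _ i ⟩
    matVec N′ᵀ (matVec N (matVec (transpose N) d)) i   ≡⟨ matVec-congʳ N′ᵀ (N*Nᵀ-eigen ∑d≡0) i ⟩
    matVec N′ᵀ (λ p → order * d p) i                   ≡⟨ matVec-* N′ᵀ order d i ⟩
    order * matVec N′ᵀ d i                             ∎
    where
    N′ᵀ : Fin b′ → Fin v → ℚ
    N′ᵀ = transpose (incidence B′)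

  0<b : 0 < b
  0<b with positivity
  ... | inj₁ (0<b , _)  = 0<b
  ... | inj₂ (refl , _) = ℕ.≤-trans (s≤s z≤n) k<v

  0<k : 0 < k
  0<k with positivity
  ... | inj₁ (_ , _ , 0<k , _)  = 0<k
  ... | inj₂ (_ , _ , refl , _) = s≤s z≤n

  separating-block : ∃ λ j → ∃₂ λ x y → x ∈ B j × y ∉ B j
  separating-block =
    let j        = Fin.fromℕ< 0<b
        (x , x∈) = 0<∣p∣⇒Nonempty (B j) (subst (0 <_) (sym (blockSize j)) 0<k)
        (y , y∉) = ∣p∣<n⇒Nonfull (B j) (subst (_< v) (sym (blockSize j)) k<v)
    in j , x , y , x∈ , y∉

module _ {v b₁ r₁ k₁ l₁ b₂ r₂ k₂ l₂ : ℕ} {B₁ : Fin b₁ → Subset v} {B₂ : Fin b₂ → Subset v}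
         (D₁ : IsBlockDesign v b₁ r₁ k₁ l₁ B₁) (D₂ : IsBlockDesign v b₂ r₂ k₂ l₂ B₂) where

  private
    module D₁ = BlockDesign D₁
    module D₂ = BlockDesign D₂

    M : Fin b₁ → Fin b₂ → ℚ
    M = interMat B₁ B₂

  N₁ᵀ-eigen : ∀ {d : Fin v → ℚ} → ∑ d ≡ 0ℚ →
              InEigenspace (matMul M (transpose M)) (D₁.order * D₂.order) (matVec (transpose D₁.N) d)
  N₁ᵀ-eigen {d} ∑d≡0 i = begin
    matVec (matMul M (transpose M)) w i              ≡⟨ matVec-matMul M (transpose M) w i ⟩
    matVec M (matVec (transpose M) w) i              ≡⟨ matVec-congʳ M Mᵀw≡order₁*N₂ᵀd i ⟩
    matVec M (λ j → D₁.order * matVec N₂ᵀ d j) i     ≡⟨ matVec-* M D₁.order (matVec N₂ᵀ d) i ⟩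
    D₁.order * matVec M (matVec N₂ᵀ d) i             ≡⟨ cong (D₁.order *_) (D₂.interMat-eigen B₁ ∑d≡0 i) ⟩
    D₁.order * (D₂.order * w i)                      ≡⟨ ℚ.*-assoc D₁.order D₂.order (w i) ⟨
    D₁.order * D₂.order * w i                        ∎
    where
    w : Fin b₁ → ℚ
    w = matVec (transpose D₁.N) d
    N₂ᵀ : Fin b₂ → Fin v → ℚ
    N₂ᵀ = transpose D₂.N
    Mᵀw≡order₁*N₂ᵀd : ∀ j → matVec (transpose M) w j ≡ D₁.order * matVec N₂ᵀ d j
    Mᵀw≡order₁*N₂ᵀd j = trans (matVec-congˡ (transpose-interMat B₁ B₂) w j) (D₁.interMat-eigen B₂ ∑d≡0 j)

  Zvec-eigen : ∀ x y → InEigenspace (matMul M (transpose M)) (D₁.order * D₂.order) (Zvec B₁ x y)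
  Zvec-eigen x y = InEigenspace-resp (matMul M (transpose M)) (D₁.order * D₂.order)
                     (sym ∘ Zvec≡Nᵀ[δ-δ] B₁ x y) (N₁ᵀ-eigen (∑-δ-δ x y))

lemma4 : ∀ (v b₁ r₁ k₁ l₁ b₂ r₂ k₂ l₂ : ℕ)
           (B₁ : Fin b₁ → Subset v) (B₂ : Fin b₂ → Subset v) →
           IsBlockDesign v b₁ r₁ k₁ l₁ B₁ →
           IsBlockDesign v b₂ r₂ k₂ l₂ B₂ →
           IsEigenvalue (matMul (interMat B₁ B₂) (transpose (interMat B₁ B₂)))
                        (ℤ→ℚ (r₁ ⊖ l₁) * ℤ→ℚ (r₂ ⊖ l₂))
           × EigenspaceContains (matMul (interMat B₁ B₂) (transpose (interMat B₁ B₂)))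
                                (ℤ→ℚ (r₁ ⊖ l₁) * ℤ→ℚ (r₂ ⊖ l₂))
                                (InSpanZ B₁)
lemma4 v b₁ r₁ k₁ l₁ b₂ r₂ k₂ l₂ B₁ B₂ D₁ D₂ =
  let M = interMat B₁ B₂
      μ = ℤ→ℚ (r₁ ⊖ l₁) * ℤ→ℚ (r₂ ⊖ l₂)
      (j , x , y , x∈ , y∉) = BlockDesign.separating-block D₁
      Zⱼ≢0 : Zvec B₁ x y j ≢ 0ℚ
      Zⱼ≢0 Zⱼ≡0 = ℚ.1≢0 (trans (sym (Zvec-∈-∉ B₁ x∈ y∉)) Zⱼ≡0)
  in (Zvec B₁ x y , (j , Zⱼ≢0) , Zvec-eigen D₁ D₂ x y)
     , span-Zvec⊆eigenspace (matMul M (transpose M)) μ B₁ (Zvec-eigen D₁ D₂)
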